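{- Let $p$ be a prime, $d\ge 1$ an integer, and $G\cong\mathbb{Z}_p^d$. Then for any non-empty subset $A$ of $\{1,2,\dots,p-1\}$, \[ d_A(G)\le\left\lceil\frac{d(p-1)+1}{|A|}\right\rceil . \]
   Context: For a finite abelian group $G$ (written additively) of exponent $n$ and a non-empty subset $A\subseteq\{1,\dots,n\}$, $d_A(G)$ denotes the least positive integer $t$ such that every sequence $(g_1,\dots,g_t)$ of $t$ (not necessarily distinct) elements of $G$ has a non-empty subsequence $g_{i_1},\dots,g_{i_\ell}$ (distinct indices) and elements $a_1,\dots,a_\ell\in A$ (not necessarily distinct) with $\sum_{j=1}^{\ell}a_j g_{i_j}=0$ in $G$. $\mathbb{Z}_p^d$ is the direct sum of $d$ copies of $\mathbb{Z}_p=\mathbb{Z}/p\mathbb{Z}$; $\lceil x\rceil$ is the smallest integer $\ge x$. -}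

module Defs where

open import Data.Nat using (ℕ; zero; suc; _+_; _*_; _∸_; _≤_; _<_)
open import Data.Nat.DivMod using (_/_)
open import Data.Nat.Divisibility using (_∣_)
open import Data.Fin using (Fin; zero; suc; toℕ)
open import Data.Fin.Subset using (Subset; Nonempty; _∈_)
open import Data.Vec using (lookup)
open import Data.Bool using (if_then_else_)
open import Data.Product using (Σ; ∃; _×_)
open import Relation.Nullary using (¬_)

sumFin : (n : ℕ) → (Fin n → ℕ) → ℕ
sumFin zero    f = 0
sumFin (suc n) f = f zero + sumFin n (λ i → f (suc i))

-- ceiling division: ⌈ m / k ⌉ for k ≥ 1 (value 0 for k = 0, never used)
ceilDiv : ℕ → ℕ → ℕ
ceilDiv m zero    = 0
ceilDiv m (suc k) = (m + k) / suc k

Elem : ℕ → ℕ → Set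
Elem p d = Fin d → Fin p

-- Weights are residues in A ⊆ Fin p, i.e. A ⊆ {0,…,p-1}, used via toℕ.
HasAZeroSum : (p d t : ℕ) → Subset p → (Fin t → Elem p d) → Set
HasAZeroSum p d t A g =
  Σ (Subset t) λ S → Nonempty S ×
  Σ (Fin t → Fin p) λ a → (∀ i → i ∈ S → a i ∈ A) ×
  (∀ (k : Fin d) →
     p ∣ sumFin t (λ i → if lookup S i then toℕ (a i) * toℕ (g i k) else 0))

AProperty : (p d : ℕ) → Subset p → ℕ → Set
AProperty p d A t = ∀ (g : Fin t → Elem p d) → HasAZeroSum p d t A g

IsDA : (p d : ℕ) → Subset p → ℕ → Set
IsDA p d A m = 1 ≤ m × AProperty p d A m × (∀ t → 1 ≤ t → t < m → ¬ AProperty p d A t)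

{-# OPTIONS --safe #-}
-- Let n = ⌈(d(p-1)+1)/|A|⌉. A sequence g₁, …, gₙ in ℤ_p^d defines d linear forms
-- Lₖ(x) = Σᵢ xᵢ gᵢₖ, and a nonzero x in the grid ({0} ∪ A)ⁿ with L(x) = 0 is exactly an
-- A-weighted zero-sum subsequence: the support of x, with weights xᵢ. Such an x exists because
-- E = ∏ₖ ∏_{c ≠ 0} (Lₖ - c) has degree d(p-1) < n|A| and E(0) ≠ 0: the n-fold tensor product of
-- the divided difference on the |A| + 1 nodes {0} ∪ A annihilates every polynomial of degree below
-- n|A| but not a function supported at the origin of the grid, so E is nonzero at some other grid
-- point x, and E(x) ≠ 0 forces L(x) = 0. The least such length exists because the zero-sum property
-- of a given length is decidable by finite search.
module Submission where

open import Defs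
open import Data.Nat using (ℕ; _+_; _*_; _∸_; _≤_)
open import Data.Nat.Primality using (Prime)
open import Data.Fin using (toℕ)
open import Data.Fin.Subset using (Subset; Nonempty; _∈_; ∣_∣)
open import Data.Product using (Σ; _×_)

open import Level using (0ℓ)
open import Data.Bool using (Bool; if_then_else_)
open import Data.Empty using (⊥-elim)
open import Data.Fin using (Fin; zero; suc)
import Data.Fin.Properties as Fin
open import Data.Fin.Subset using (inside; outside)
open import Data.Fin.Subset.Properties using (anySubset?; nonempty?; _∈?_; x∈p⇒∣p-x∣<∣p∣)
open import Data.List using (List; []; _∷_; _++_; map; foldr; length; applyUpTo; allFin; cartesianProduct)
import Data.List.Properties as List
open import Data.List.Membership.Propositional using () renaming (_∈_ to _∈ₗ_)
open import Data.List.Membership.Propositional.Properties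
  using (∈-map⁻; ∈-map⁺; ∈-applyUpTo⁺; ∈-applyUpTo⁻; ∈-cartesianProduct⁺; ∈-cartesianProduct⁻; ∈-allFin)
open import Data.List.Relation.Unary.All using (All; []; _∷_)
import Data.List.Relation.Unary.All as All
import Data.List.Relation.Unary.All.Properties as All
open import Data.List.Relation.Unary.Any using (here; there)
open import Data.List.Relation.Unary.AllPairs using ([]; _∷_)
import Data.List.Relation.Unary.AllPairs as AllPairs
open import Data.List.Relation.Unary.Unique.Propositional using (Unique)
import Data.List.Relation.Unary.Unique.Propositional.Properties as Unique
open import Data.Nat using (zero; suc; _<_; _^_; z≤n; s≤s; s≤s⁻¹; nonTrivial⇒n>1)
open import Data.Nat.Properties
open import Algebra.Properties.CommutativeSemigroup *-commutativeSemigroup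
  using () renaming (interchange to *-interchange)
open import Algebra.Properties.CommutativeSemigroup +-commutativeSemigroup
  using () renaming (interchange to +-interchange)
open import Data.Nat.Divisibility using (_∣_; _∣?_; m%n≡0⇒n∣m; n∣m⇒m%n≡0)
open import Data.Nat.DivMod
  using (_%_; _/_; m≡m%n+[m/n]*n; %-distribˡ-+; %-distribˡ-*; [m+kn]%n≡m%n; m<n⇒m%n≡m; m%n%n≡m%n; m%n<n)
open import Data.Nat.GCD using (GCD; module GCD; module Bézout)
open import Data.Nat.ListAction using (product)
open import Data.Nat.Primality using (¬prime[0]; euclidsLemma; prime⇒irreducible; prime⇒nonTrivial)
open import Data.Nat.Tactic.RingSolver using (solve-∀)
open import Data.Product using (∃; _,_; proj₁; proj₂)
open import Data.Sum using (inj₁; inj₂; _⊎_)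
open import Data.Vec using (Vec; []; _∷_; lookup; tabulate; replicate; zipWith)
import Data.Vec as Vec
open import Data.Vec.Properties using (lookup∘tabulate; lookup-map; lookup⇒[]=; []=⇒lookup)
open import Data.Vec.Relation.Unary.All using ([]; _∷_)
import Data.Vec.Relation.Unary.All as VecAll
import Data.Vec.Relation.Unary.All.Properties as VecAll
import Data.Vec.Relation.Unary.Any as VecAny
import Data.Vec.Relation.Unary.Any.Properties as VecAny
open import Function using (_∘_)
open import Relation.Binary.Bundles using (Setoid)
import Relation.Binary.Reasoning.Setoid
open import Relation.Binary.PropositionalEquality
  using (_≡_; _≢_; refl; sym; trans; cong; cong₂; subst; module ≡-Reasoning)
open import Relation.Nullary using (¬_; Dec; yes; no; ¬?)
open import Relation.Nullary.Decidable using (map′; decidable-stable; _×-dec_; _→-dec_)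
open import Relation.Unary using (Pred; Decidable)

Searchable : Set → Set₁
Searchable X = ∀ {P : Pred X 0ℓ} → Decidable P → Dec (∃ P)

searchable-Fin : ∀ n → Searchable (Fin n)
searchable-Fin n = Fin.any?

searchable-Vec : ∀ {X} → Searchable X → ∀ n → Searchable (Vec X n)
searchable-Vec search zero    P? = map′ ([] ,_) (λ { ([] , p) → p }) (P? [])
searchable-Vec search (suc n) P? =
  map′ (λ (x , xs , p) → x ∷ xs , p) (λ { (x ∷ xs , p) → x , xs , p })
       (search (λ x → searchable-Vec search n (λ xs → P? (x ∷ xs))))

searchable⇒all? : ∀ {X} → Searchable X → {P : Pred X 0ℓ} → Decidable P → Dec (∀ x → P x)
searchable⇒all? search P? =
  map′ (λ ∄¬P x → decidable-stable (P? x) (λ ¬Px → ∄¬P (x , ¬Px)))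
       (λ ∀P (x , ¬Px) → ¬Px (∀P x))
       (¬? (search (¬? ∘ P?)))

IsLeastPositive : (ℕ → Set) → ℕ → Set
IsLeastPositive P m = 1 ≤ m × P m × (∀ t → 1 ≤ t → t < m → ¬ P t)

least-positive-≤ : {P : ℕ → Set} → Decidable P → ∀ n →
                   (∃ λ m → IsLeastPositive P m × m ≤ n) ⊎ (∀ t → 1 ≤ t → t ≤ n → ¬ P t)
least-positive-≤ P? zero = inj₂ λ t 1≤t t≤0 _ → <⇒≱ 1≤t t≤0
least-positive-≤ {P} P? (suc n) with least-positive-≤ P? n | P? (suc n)
... | inj₁ (m , least , m≤n) | _       = inj₁ (m , least , ≤-trans m≤n (n≤1+n n))
... | inj₂ none              | yes Psn =
  inj₁ (suc n , (s≤s z≤n , Psn , λ t 1≤t t<sn → none t 1≤t (s≤s⁻¹ t<sn)) , ≤-refl)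
... | inj₂ none              | no ¬Psn = inj₂ below
  where
  below : ∀ t → 1 ≤ t → t ≤ suc n → ¬ P t
  below t 1≤t t≤sn with m≤n⇒m<n∨m≡n t≤sn
  ... | inj₁ t<sn = none t 1≤t (s≤s⁻¹ t<sn)
  ... | inj₂ refl = ¬Psn

least-positive : {P : ℕ → Set} → Decidable P → ∀ {n} → 1 ≤ n → P n →
                 ∃ λ m → IsLeastPositive P m × m ≤ n
least-positive P? {n} 1≤n Pn with least-positive-≤ P? n
... | inj₁ found = found
... | inj₂ none  = ⊥-elim (none n 1≤n ≤-refl Pn)

sumFin-cong : ∀ n {f g : Fin n → ℕ} → (∀ i → f i ≡ g i) → sumFin n f ≡ sumFin n g
sumFin-cong zero    f≡g = refl
sumFin-cong (suc n) f≡g = cong₂ _+_ (f≡g zero) (sumFin-cong n (f≡g ∘ suc))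

IsAZeroSum : (p d t : ℕ) → Subset p → (Fin t → Elem p d) → Subset t → (Fin t → Fin p) → Set
IsAZeroSum p d t A g S a =
  (∀ i → i ∈ S → a i ∈ A) ×
  (∀ k → p ∣ sumFin t (λ i → if lookup S i then toℕ (a i) * toℕ (g i k) else 0))

module _ {p d t : ℕ} {A : Subset p} where

  IsAZeroSum-resp : ∀ {g g' S a a'} → (∀ i k → g i k ≡ g' i k) → (∀ i → a i ≡ a' i) →
                    IsAZeroSum p d t A g S a → IsAZeroSum p d t A g' S a'
  IsAZeroSum-resp {S = S} g≡g' a≡a' (weights∈A , zeroSums) =
    (λ i i∈S → subst (_∈ A) (a≡a' i) (weights∈A i i∈S)) ,
    (λ k → subst (p ∣_) (sumFin-cong t λ i →
                           cong₂ (λ a x → if lookup S i then toℕ a * toℕ x else 0) (a≡a' i) (g≡g' i k))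
                        (zeroSums k))

  HasAZeroSum-resp : ∀ {g g'} → (∀ i k → g i k ≡ g' i k) → HasAZeroSum p d t A g → HasAZeroSum p d t A g'
  HasAZeroSum-resp g≡g' (S , nonempty , a , isZeroSum) =
    S , nonempty , a , IsAZeroSum-resp g≡g' (λ _ → refl) isZeroSum

  hasAZeroSum? : ∀ g → Dec (HasAZeroSum p d t A g)
  hasAZeroSum? g = anySubset? λ S → nonempty? S ×-dec weights? S
    where
    isAZeroSum? : ∀ S a → Dec (IsAZeroSum p d t A g S a)
    isAZeroSum? S a = Fin.all? (λ i → i ∈? S →-dec a i ∈? A) ×-dec Fin.all? (λ k → p ∣? _)

    weights? : ∀ S → Dec (∃ (IsAZeroSum p d t A g S))
    weights? S =
      map′ (λ (w , isZeroSum) → lookup w , isZeroSum)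
           (λ (a , isZeroSum) → tabulate a ,
              IsAZeroSum-resp (λ _ _ → refl) (sym ∘ lookup∘tabulate a) isZeroSum)
           (searchable-Vec (searchable-Fin p) t (isAZeroSum? S ∘ lookup))

aProperty? : ∀ p d A t → Dec (AProperty p d A t)
aProperty? p d A t =
  map′ (λ ∀w g → HasAZeroSum-resp (λ i k → lookup∘tabulate-twice g i k) (∀w (tabulate (tabulate ∘ g))))
       (λ ap w → ap _)
       (searchable⇒all? (searchable-Vec (searchable-Vec (searchable-Fin p) d) t)
                        (λ w → hasAZeroSum? (λ i k → lookup (lookup w i) k)))
  where
  lookup∘tabulate-twice : ∀ (g : Fin t → Elem p d) i k →
                          lookup (lookup (tabulate (tabulate ∘ g)) i) k ≡ g i k
  lookup∘tabulate-twice g i k rewrite lookup∘tabulate (tabulate ∘ g) i = lookup∘tabulate (g i) k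

Monomial : ℕ → Set
Monomial t = Vec ℕ t

Poly : ℕ → Set
Poly t = List (ℕ × Monomial t)

monomial : ∀ {n} → Monomial n → Vec ℕ n → ℕ
monomial []       []       = 1
monomial (e ∷ es) (x ∷ xs) = x ^ e * monomial es xs

⟦_⟧ : ∀ {t} → Poly t → Vec ℕ t → ℕ
⟦ []          ⟧ v = 0
⟦ (a , e) ∷ P ⟧ v = a * monomial e v + ⟦ P ⟧ v

degree : ∀ {n} → Monomial n → ℕ
degree = Vec.sum

Degree≤ : ∀ {t} → ℕ → Poly t → Set
Degree≤ D = All (λ τ → degree (proj₂ τ) ≤ D)

⟦++⟧ : ∀ {t} (P Q : Poly t) v → ⟦ P ++ Q ⟧ v ≡ ⟦ P ⟧ v + ⟦ Q ⟧ v
⟦++⟧ []            Q v = refl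
⟦++⟧ ((a , e) ∷ P) Q v =
  trans (cong (a * monomial e v +_) (⟦++⟧ P Q v)) (sym (+-assoc (a * monomial e v) _ _))

Degree≤-++ : ∀ {t D} {P Q : Poly t} → Degree≤ D P → Degree≤ D Q → Degree≤ D (P ++ Q)
Degree≤-++ []         dQ = dQ
Degree≤-++ (dτ ∷ dP) dQ = dτ ∷ Degree≤-++ dP dQ

infixl 7 _*ᴾ_
_*ᴾ_ : ∀ {t} → Poly t → Poly t → Poly t
[]            *ᴾ Q = []
((a , e) ∷ P) *ᴾ Q = map (λ (b , f) → a * b , zipWith _+_ e f) Q ++ P *ᴾ Q

∏ᴾ : ∀ {t} → List (Poly t) → Poly t
∏ᴾ {t} = foldr _*ᴾ_ ((1 , replicate t 0) ∷ [])

monomial-+ : ∀ {n} (e f : Monomial n) x → monomial (zipWith _+_ e f) x ≡ monomial e x * monomial f x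
monomial-+ []       []       []       = refl
monomial-+ (e ∷ es) (f ∷ fs) (x ∷ xs) = begin
  x ^ (e + f) * monomial (zipWith _+_ es fs) xs   ≡⟨ cong₂ _*_ (^-distribˡ-+-* x e f) (monomial-+ es fs xs) ⟩
  (x ^ e * x ^ f) * (monomial es xs * monomial fs xs) ≡⟨ *-interchange (x ^ e) (x ^ f) _ _ ⟩
  x ^ e * monomial es xs * (x ^ f * monomial fs xs) ∎
  where open ≡-Reasoning

monomial-0 : ∀ {n} (x : Vec ℕ n) → monomial (replicate n 0) x ≡ 1
monomial-0 []       = refl
monomial-0 (x ∷ xs) = trans (+-identityʳ _) (monomial-0 xs)

degree-0 : ∀ n → degree (replicate n 0) ≡ 0
degree-0 zero    = refl
degree-0 (suc n) = degree-0 n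

degree-+ : ∀ {n} (e f : Monomial n) → degree (zipWith _+_ e f) ≡ degree e + degree f
degree-+ []       []       = refl
degree-+ (e ∷ es) (f ∷ fs) = trans (cong (e + f +_) (degree-+ es fs)) (+-interchange e f _ _)

⟦*ᴾ⟧ : ∀ {t} (P Q : Poly t) v → ⟦ P *ᴾ Q ⟧ v ≡ ⟦ P ⟧ v * ⟦ Q ⟧ v
⟦*ᴾ⟧ []            Q v = refl
⟦*ᴾ⟧ ((a , e) ∷ P) Q v = begin
  ⟦ scaled Q ++ P *ᴾ Q ⟧ v                       ≡⟨ ⟦++⟧ (scaled Q) (P *ᴾ Q) v ⟩
  ⟦ scaled Q ⟧ v + ⟦ P *ᴾ Q ⟧ v                  ≡⟨ cong₂ _+_ (⟦scaled⟧ Q) (⟦*ᴾ⟧ P Q v) ⟩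
  a * monomial e v * ⟦ Q ⟧ v + ⟦ P ⟧ v * ⟦ Q ⟧ v ≡⟨ *-distribʳ-+ (⟦ Q ⟧ v) (a * monomial e v) (⟦ P ⟧ v) ⟨
  (a * monomial e v + ⟦ P ⟧ v) * ⟦ Q ⟧ v         ∎
  where
  open ≡-Reasoning
  scaled : Poly _ → Poly _
  scaled = map (λ (b , f) → a * b , zipWith _+_ e f)
  ⟦scaled⟧ : ∀ (Q : Poly _) → ⟦ scaled Q ⟧ v ≡ a * monomial e v * ⟦ Q ⟧ v
  ⟦scaled⟧ []            = sym (*-zeroʳ (a * monomial e v))
  ⟦scaled⟧ ((b , f) ∷ Q) = begin
    a * b * monomial (zipWith _+_ e f) v + ⟦ scaled Q ⟧ v
      ≡⟨ cong₂ (λ m r → a * b * m + r) (monomial-+ e f v) (⟦scaled⟧ Q) ⟩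
    a * b * (monomial e v * monomial f v) + a * monomial e v * ⟦ Q ⟧ v
      ≡⟨ distribute a b (monomial e v) (monomial f v) (⟦ Q ⟧ v) ⟩
    a * monomial e v * (b * monomial f v + ⟦ Q ⟧ v) ∎
    where
    distribute : ∀ a b mₑ m_f r → a * b * (mₑ * m_f) + a * mₑ * r ≡ a * mₑ * (b * m_f + r)
    distribute = solve-∀

Degree≤-*ᴾ : ∀ {t D E} (P Q : Poly t) → Degree≤ D P → Degree≤ E Q → Degree≤ (D + E) (P *ᴾ Q)
Degree≤-*ᴾ []            Q []         dQ = []
Degree≤-*ᴾ ((a , e) ∷ P) Q (de ∷ dP) dQ = Degree≤-++ (scaled Q dQ) (Degree≤-*ᴾ P Q dP dQ)
  where
  scaled : ∀ (Q : Poly _) → Degree≤ _ Q → Degree≤ _ (map (λ (b , f) → a * b , zipWith _+_ e f) Q)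
  scaled []            []         = []
  scaled ((b , f) ∷ Q) (df ∷ dQ) =
    subst (_≤ _) (sym (degree-+ e f)) (+-mono-≤ de df) ∷ scaled Q dQ

⟦∏ᴾ⟧ : ∀ {t} (Ps : List (Poly t)) v → ⟦ ∏ᴾ Ps ⟧ v ≡ product (map (λ P → ⟦ P ⟧ v) Ps)
⟦∏ᴾ⟧ []       v = trans (+-identityʳ _) (trans (+-identityʳ _) (monomial-0 v))
⟦∏ᴾ⟧ (P ∷ Ps) v = trans (⟦*ᴾ⟧ P (∏ᴾ Ps) v) (cong (⟦ P ⟧ v *_) (⟦∏ᴾ⟧ Ps v))

Degree≤-∏ᴾ : ∀ {t D} (Ps : List (Poly t)) → All (Degree≤ D) Ps → Degree≤ (length Ps * D) (∏ᴾ Ps)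
Degree≤-∏ᴾ {t} []       []         = subst (_≤ 0) (sym (degree-0 t)) z≤n ∷ []
Degree≤-∏ᴾ (P ∷ Ps) (dP ∷ dPs) = Degree≤-*ᴾ P (∏ᴾ Ps) dP (Degree≤-∏ᴾ Ps dPs)

affine : ∀ {t} → ℕ → (Fin t → ℕ) → Poly t
affine {zero}  b a = (b , []) ∷ []
affine {suc t} b a = (a zero , 1 ∷ replicate t 0) ∷ map shift (affine b (a ∘ suc))
  where
  shift : ℕ × Monomial t → ℕ × Monomial (suc t)
  shift (c , e) = c , 0 ∷ e

⟦affine⟧ : ∀ {t} b (a : Fin t → ℕ) v → ⟦ affine b a ⟧ v ≡ b + sumFin t (λ i → lookup v i * a i)
⟦affine⟧ {zero}  b a []       = cong (_+ 0) (*-identityʳ b)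
⟦affine⟧ {suc t} b a (x ∷ v) = begin
  a zero * (x ^ 1 * monomial (replicate t 0) v) + ⟦ map _ (affine b (a ∘ suc)) ⟧ (x ∷ v)
    ≡⟨ cong₂ (λ m r → a zero * (x ^ 1 * m) + r) (monomial-0 v) (⟦shift⟧ (affine b (a ∘ suc))) ⟩
  a zero * (x * 1 * 1) + ⟦ affine b (a ∘ suc) ⟧ v
    ≡⟨ cong (a zero * (x * 1 * 1) +_) (⟦affine⟧ b (a ∘ suc) v) ⟩
  a zero * (x * 1 * 1) + (b + sumFin t _)
    ≡⟨ rearrange (a zero) x b _ ⟩
  b + (x * a zero + sumFin t _) ∎
  where
  open ≡-Reasoning
  ⟦shift⟧ : ∀ (P : Poly t) → ⟦ map (λ (c , e) → c , 0 ∷ e) P ⟧ (x ∷ v) ≡ ⟦ P ⟧ v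
  ⟦shift⟧ []            = refl
  ⟦shift⟧ ((c , e) ∷ P) = cong₂ (λ m r → c * m + r) (+-identityʳ _) (⟦shift⟧ P)
  rearrange : ∀ a x b s → a * (x * 1 * 1) + (b + s) ≡ b + (x * a + s)
  rearrange = solve-∀

Degree≤-affine : ∀ {t} b (a : Fin t → ℕ) → Degree≤ 1 (affine b a)
Degree≤-affine {zero}  b a = z≤n ∷ []
Degree≤-affine {suc t} b a =
  subst (_≤ 1) (sym (cong suc (degree-0 t))) ≤-refl ∷ All.map⁺ (Degree≤-affine b (a ∘ suc))

-- Residues mod p = suc p-1 are natural numbers up to _≈_. Negation is multiplication by p - 1,
-- so the identities needed are semiring identities in ℕ up to multiples of p.
module Residues (p-1 : ℕ) where

  p : ℕ
  p = suc p-1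

  infix 4 _≈_ _≉_
  record _≈_ (a b : ℕ) : Set where
    constructor congruent
    field %-≡ : a % p ≡ b % p
  open _≈_

  _≉_ : ℕ → ℕ → Set
  a ≉ b = ¬ a ≈ b

  ≈-refl : ∀ {a} → a ≈ a
  ≈-refl = congruent refl

  ≈-sym : ∀ {a b} → a ≈ b → b ≈ a
  ≈-sym (congruent e) = congruent (sym e)

  ≈-trans : ∀ {a b c} → a ≈ b → b ≈ c → a ≈ c
  ≈-trans (congruent e) (congruent f) = congruent (trans e f)

  ≡⇒≈ : ∀ {a b} → a ≡ b → a ≈ b
  ≡⇒≈ e = congruent (cong (_% p) e)

  ≈-setoid : Setoid 0ℓ 0ℓ
  ≈-setoid = record
    { Carrier = ℕ ; _≈_ = _≈_
    ; isEquivalence = record { refl = ≈-refl ; sym = ≈-sym ; trans = ≈-trans } }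

  module ≈-Reasoning = Relation.Binary.Reasoning.Setoid ≈-setoid

  _≈?_ : ∀ a b → Dec (a ≈ b)
  a ≈? b = map′ congruent %-≡ (a % p ≟ b % p)

  +-cong : ∀ {a a' b b'} → a ≈ a' → b ≈ b' → a + b ≈ a' + b'
  +-cong {a} {a'} {b} {b'} (congruent e) (congruent f) = congruent (begin
    (a + b) % p             ≡⟨ %-distribˡ-+ a b p ⟩
    (a % p + b % p) % p     ≡⟨ cong₂ (λ x y → (x + y) % p) e f ⟩
    (a' % p + b' % p) % p   ≡⟨ %-distribˡ-+ a' b' p ⟨
    (a' + b') % p           ∎)
    where open ≡-Reasoning

  *-cong : ∀ {a a' b b'} → a ≈ a' → b ≈ b' → a * b ≈ a' * b'
  *-cong {a} {a'} {b} {b'} (congruent e) (congruent f) = congruent (begin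
    (a * b) % p             ≡⟨ %-distribˡ-* a b p ⟩
    (a % p * (b % p)) % p   ≡⟨ cong₂ (λ x y → (x * y) % p) e f ⟩
    (a' % p * (b' % p)) % p ≡⟨ %-distribˡ-* a' b' p ⟨
    (a' * b') % p           ∎)
    where open ≡-Reasoning

  *-congˡ : ∀ a {b b'} → b ≈ b' → a * b ≈ a * b'
  *-congˡ a = *-cong (≈-refl {a})

  *-congʳ : ∀ b {a a'} → a ≈ a' → a * b ≈ a' * b
  *-congʳ b a≈a' = *-cong a≈a' (≈-refl {b})

  +-p* : ∀ a k → a + p * k ≈ a
  +-p* a k = congruent (trans (cong (λ m → (a + m) % p) (*-comm p k)) ([m+kn]%n≡m%n a k p))

  ≈0⇒∣ : ∀ {a} → a ≈ 0 → p ∣ a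
  ≈0⇒∣ (congruent e) = m%n≡0⇒n∣m _ _ e

  ∣⇒≈0 : ∀ {a} → p ∣ a → a ≈ 0
  ∣⇒≈0 p∣a = congruent (n∣m⇒m%n≡0 _ _ p∣a)

  ≈-%  : ∀ a → a ≈ a % p
  ≈-% a = congruent (sym (m%n%n≡m%n a p))

  nonzeroResidues : List ℕ
  nonzeroResidues = applyUpTo suc p-1

  %∈nonzeroResidues : ∀ a → a ≉ 0 → a % p ∈ₗ nonzeroResidues
  %∈nonzeroResidues a a≉0 with a % p in a%p≡r | m%n<n a p
  ... | zero  | _       = ⊥-elim (a≉0 (congruent a%p≡r))
  ... | suc r | r+1<p   = ∈-applyUpTo⁺ suc (s≤s⁻¹ r+1<p)

  <p-≈⇒≡ : ∀ {a b} → a < p → b < p → a ≈ b → a ≡ b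
  <p-≈⇒≡ a<p b<p (congruent e) = trans (sym (m<n⇒m%n≡m a<p)) (trans e (m<n⇒m%n≡m b<p))

  residue-≉0 : ∀ {a} → 1 ≤ a → a < p → a ≉ 0
  residue-≉0 1≤a a<p a≈0 = <⇒≱ 1≤a (≤-reflexive (<p-≈⇒≡ a<p (s≤s z≤n) a≈0))

  toℕ-≈-injective : ∀ {x y : Fin p} → toℕ x ≈ toℕ y → x ≡ y
  toℕ-≈-injective {x} {y} = Fin.toℕ-injective ∘ <p-≈⇒≡ (Fin.toℕ<n x) (Fin.toℕ<n y)

  -_ : ℕ → ℕ
  - a = p-1 * a

  infixl 6 _-_
  _-_ : ℕ → ℕ → ℕ
  a - b = a + - b

  -‿cong : ∀ {a b} → a ≈ b → - a ≈ - b
  -‿cong = *-congˡ p-1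

  -‿cong₂ : ∀ {a a' b b'} → a ≈ a' → b ≈ b' → a - b ≈ a' - b'
  -‿cong₂ a≈a' b≈b' = +-cong a≈a' (-‿cong b≈b')

  x-x≈0 : ∀ a → a - a ≈ 0
  x-x≈0 a = +-p* 0 a

  x-y≈0⇒x≈y : ∀ {a b} → a - b ≈ 0 → a ≈ b
  x-y≈0⇒x≈y {a} {b} a-b≈0 = begin
    a               ≈⟨ +-p* a b ⟨
    a + p * b       ≡⟨ regroup p-1 a b ⟩
    (a - b) + b     ≈⟨ +-cong a-b≈0 (≈-refl {b}) ⟩
    b               ∎
    where
    open ≈-Reasoning
    regroup : ∀ p-1 a b → a + suc p-1 * b ≡ a + p-1 * b + b
    regroup = solve-∀

  x-0≡x : ∀ a → a - 0 ≡ a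
  x-0≡x a = trans (cong (a +_) (*-zeroʳ p-1)) (+-identityʳ a)

  geometric : ℕ → ℕ → ℕ → ℕ
  geometric x c zero    = 0
  geometric x c (suc e) = x ^ e + c * geometric x c e

  x^e-c^e≈[x-c]*geometric : ∀ x c e → x ^ e - c ^ e ≈ (x - c) * geometric x c e
  x^e-c^e≈[x-c]*geometric x c zero    = ≈-trans (x-x≈0 1) (≡⇒≈ (sym (*-zeroʳ (x - c))))
  x^e-c^e≈[x-c]*geometric x c (suc e) = ≈-sym (begin
    (x - c) * (x ^ e + c * geometric x c e)
      ≡⟨ expand p-1 x c (x ^ e) (geometric x c e) ⟩
    (x - c) * x ^ e + c * ((x - c) * geometric x c e)
      ≈⟨ +-cong (≈-refl {(x - c) * x ^ e}) (*-congˡ c (≈-sym (x^e-c^e≈[x-c]*geometric x c e))) ⟩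
    (x - c) * x ^ e + c * (x ^ e - c ^ e)
      ≡⟨ telescope p-1 x c (x ^ e) (c ^ e) ⟩
    x * x ^ e - c * c ^ e + p * (c * x ^ e)
      ≈⟨ +-p* _ (c * x ^ e) ⟩
    x * x ^ e - c * c ^ e ∎)
    where
    open ≈-Reasoning
    expand : ∀ p-1 x c xᵉ g → (x + p-1 * c) * (xᵉ + c * g) ≡ (x + p-1 * c) * xᵉ + c * ((x + p-1 * c) * g)
    expand = solve-∀
    telescope : ∀ p-1 x c xᵉ cᵉ →
      (x + p-1 * c) * xᵉ + c * (xᵉ + p-1 * cᵉ) ≡ x * xᵉ + p-1 * (c * cᵉ) + suc p-1 * (c * xᵉ)
    telescope = solve-∀

  product-≈0 : ∀ {a} xs → a ∈ₗ xs → a ≈ 0 → product xs ≈ 0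
  product-≈0 (x ∷ xs) (here refl) a≈0 = *-congʳ (product xs) a≈0
  product-≈0 (x ∷ xs) (there a∈xs) a≈0 =
    ≈-trans (*-congˡ x (product-≈0 xs a∈xs a≈0)) (≡⇒≈ (*-zeroʳ x))

module PrimeField {p-1 : ℕ} (p-prime : Prime (suc p-1)) where

  open Residues p-1 public

  1<p : 1 < p
  1<p = nonTrivial⇒n>1 p {{prime⇒nonTrivial p-prime}}

  1≉0 : 1 ≉ 0
  1≉0 = residue-≉0 ≤-refl 1<p

  *-≉0 : ∀ {a b} → a ≉ 0 → b ≉ 0 → a * b ≉ 0
  *-≉0 {a} {b} a≉0 b≉0 ab≈0 with euclidsLemma a b p-prime (≈0⇒∣ ab≈0)
  ... | inj₁ p∣a = a≉0 (∣⇒≈0 p∣a)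
  ... | inj₂ p∣b = b≉0 (∣⇒≈0 p∣b)

  product-≉0 : ∀ {xs} → All (_≉ 0) xs → product xs ≉ 0
  product-≉0 []           = 1≉0
  product-≉0 (x≉0 ∷ xs≉0) = *-≉0 x≉0 (product-≉0 xs≉0)

  nonzeroResidue⇒-≉0 : ∀ {c} → c ∈ₗ nonzeroResidues → - c ≉ 0
  nonzeroResidue⇒-≉0 c∈ with _ , j<p-1 , refl ← ∈-applyUpTo⁻ suc c∈ =
    *-≉0 (residue-≉0 (s≤s⁻¹ 1<p) ≤-refl) (residue-≉0 (s≤s z≤n) (s≤s j<p-1))

  gcd≡1 : ∀ {a g} → a ≉ 0 → GCD a p g → g ≡ 1
  gcd≡1 a≉0 gcd with prime⇒irreducible p-prime (GCD.gcd∣n gcd)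
  ... | inj₁ g≡1    = g≡1
  ... | inj₂ refl   = ⊥-elim (a≉0 (∣⇒≈0 (GCD.gcd∣m gcd)))

  -- The Bézout coefficients of a and p give the inverse; for a ≡ 0 (mod p) the value is junk.
  inv : ℕ → ℕ
  inv a with Bézout.lemma a p
  ... | Bézout.result _ _ (Bézout.+- x _ _) = x
  ... | Bézout.result _ _ (Bézout.-+ x _ _) = - x

  *-inverseʳ : ∀ {a} → a ≉ 0 → a * inv a ≈ 1
  *-inverseʳ {a} a≉0 with Bézout.lemma a p
  ... | Bézout.result g gcd (Bézout.+- x y eq) rewrite gcd≡1 a≉0 gcd = begin
    a * x         ≡⟨ *-comm a x ⟩
    x * a         ≡⟨ eq ⟨
    1 + y * p     ≡⟨ cong (1 +_) (*-comm y p) ⟩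
    1 + p * y     ≈⟨ +-p* 1 y ⟩
    1             ∎
    where open ≈-Reasoning
  ... | Bézout.result g gcd (Bézout.-+ x y eq) rewrite gcd≡1 a≉0 gcd = begin
    a * - x                   ≈⟨ +-p* (a * - x) y ⟨
    a * - x + p * y           ≡⟨ cong (λ m → a * - x + m) (trans (*-comm p y) (sym eq)) ⟩
    a * - x + (1 + x * a)     ≡⟨ regroup p-1 a x ⟩
    1 + p * (x * a)           ≈⟨ +-p* 1 (x * a) ⟩
    1                         ∎
    where
    open ≈-Reasoning
    regroup : ∀ p-1 a x → a * (p-1 * x) + (1 + x * a) ≡ 1 + suc p-1 * (x * a)
    regroup = solve-∀

  inv-≉0 : ∀ {a} → a ≉ 0 → inv a ≉ 0
  inv-≉0 {a} a≉0 inv≈0 =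
    1≉0 (≈-trans (≈-sym (*-inverseʳ a≉0)) (≈-trans (*-congˡ a inv≈0) (≡⇒≈ (*-zeroʳ a))))

module DividedDifference {p-1 : ℕ} (p-prime : Prime (suc p-1)) where

  open PrimeField p-prime

  -- divDiff z (c₁ ∷ … ∷ cₙ) f is the divided difference f[c₁, …, cₙ, z] of the function f on the
  -- residues, where the last node z is kept fixed through the recursion.
  divDiff : Fin p → List (Fin p) → (Fin p → ℕ) → ℕ
  divDiff z []      f = f z
  divDiff z (c ∷ B) f = divDiff z B (λ x → (f x - f c) * inv (toℕ x - toℕ c))

  divDiff-cong : ∀ z B {f g} → (∀ x → x ∈ₗ z ∷ B → f x ≈ g x) → divDiff z B f ≈ divDiff z B g
  divDiff-cong z []      f≈g = f≈g z (here refl)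
  divDiff-cong z (c ∷ B) f≈g = divDiff-cong z B λ x x∈ →
    *-congʳ (inv (toℕ x - toℕ c)) (-‿cong₂ (f≈g x (skip x∈)) (f≈g c (there (here refl))))
    where
    skip : ∀ {x} → x ∈ₗ z ∷ B → x ∈ₗ z ∷ c ∷ B
    skip (here x≡z) = here x≡z
    skip (there x∈B) = there (there x∈B)

  divDiff-+ : ∀ z B f g → divDiff z B (λ x → f x + g x) ≈ divDiff z B f + divDiff z B g
  divDiff-+ z []      f g = ≈-refl
  divDiff-+ z (c ∷ B) f g =
    ≈-trans (divDiff-cong z B λ x _ → ≡⇒≈ (distrib p-1 (f x) (g x) (f c) (g c) _)) (divDiff-+ z B _ _)
    where
    distrib : ∀ p-1 fx gx fc gc i →
      (fx + gx + p-1 * (fc + gc)) * i ≡ (fx + p-1 * fc) * i + (gx + p-1 * gc) * i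
    distrib = solve-∀

  divDiff-*ˡ : ∀ z B a f → divDiff z B (λ x → a * f x) ≈ a * divDiff z B f
  divDiff-*ˡ z []      a f = ≈-refl
  divDiff-*ˡ z (c ∷ B) a f =
    ≈-trans (divDiff-cong z B λ x _ → ≡⇒≈ (distrib p-1 a (f x) (f c) _)) (divDiff-*ˡ z B a _)
    where
    distrib : ∀ p-1 a fx fc i → (a * fx + p-1 * (a * fc)) * i ≡ a * ((fx + p-1 * fc) * i)
    distrib = solve-∀

  divDiff-0 : ∀ z B → divDiff z B (λ _ → 0) ≈ 0
  divDiff-0 z B = divDiff-*ˡ z B 0 (λ _ → 0)

  distinct-tail : ∀ {z c : Fin p} {B} → Unique (z ∷ c ∷ B) → Unique (z ∷ B)
  distinct-tail ((_ ∷ z≢B) ∷ (_ ∷ uB)) = z≢B ∷ uB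

  distinct-head : ∀ {z c x : Fin p} {B} → Unique (z ∷ c ∷ B) → x ∈ₗ z ∷ B → x ≢ c
  distinct-head ((z≢c ∷ _) ∷ _)  (here refl) = z≢c
  distinct-head (_ ∷ (c≢B ∷ _))  (there x∈B) = λ x≡c → All.lookup c≢B x∈B (sym x≡c)

  node-difference-≉0 : ∀ {x c : Fin p} → x ≢ c → toℕ x - toℕ c ≉ 0
  node-difference-≉0 x≢c = x≢c ∘ toℕ-≈-injective ∘ x-y≈0⇒x≈y

  divDiff-pow : ∀ z B → Unique (z ∷ B) → ∀ e → e < length B → divDiff z B (λ x → toℕ x ^ e) ≈ 0
  divDiff-pow z (c ∷ B) distinct e (s≤s e≤∣B∣) =
    ≈-trans (divDiff-cong z B quotient) (divDiff-geometric e e≤∣B∣)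
    where
    quotient : ∀ x → x ∈ₗ z ∷ B →
      (toℕ x ^ e - toℕ c ^ e) * inv (toℕ x - toℕ c) ≈ geometric (toℕ x) (toℕ c) e
    quotient x x∈ = begin
      (toℕ x ^ e - toℕ c ^ e) * inv (toℕ x - toℕ c)
        ≈⟨ *-congʳ (inv (toℕ x - toℕ c)) (x^e-c^e≈[x-c]*geometric (toℕ x) (toℕ c) e) ⟩
      ((toℕ x - toℕ c) * geometric (toℕ x) (toℕ c) e) * inv (toℕ x - toℕ c)
        ≡⟨ *-right-comm (toℕ x - toℕ c) (geometric (toℕ x) (toℕ c) e) (inv (toℕ x - toℕ c)) ⟩
      geometric (toℕ x) (toℕ c) e * ((toℕ x - toℕ c) * inv (toℕ x - toℕ c))
        ≈⟨ *-congˡ (geometric (toℕ x) (toℕ c) e)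
                   (*-inverseʳ (node-difference-≉0 (distinct-head distinct x∈))) ⟩
      geometric (toℕ x) (toℕ c) e * 1
        ≡⟨ *-identityʳ _ ⟩
      geometric (toℕ x) (toℕ c) e ∎
      where
      open ≈-Reasoning
      *-right-comm : ∀ a g i → (a * g) * i ≡ g * (a * i)
      *-right-comm = solve-∀
    divDiff-geometric : ∀ e → e ≤ length B → divDiff z B (λ x → geometric (toℕ x) (toℕ c) e) ≈ 0
    divDiff-geometric zero    _     = divDiff-0 z B
    divDiff-geometric (suc e) e<∣B∣ =
      ≈-trans (divDiff-+ z B _ _)
        (+-cong (divDiff-pow z B (distinct-tail distinct) e e<∣B∣)
                (≈-trans (divDiff-*ˡ z B (toℕ c) _)
                         (≈-trans (*-congˡ (toℕ c) (divDiff-geometric e (≤-trans (n≤1+n e) e<∣B∣)))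
                                  (≡⇒≈ (*-zeroʳ (toℕ c))))))

  divDiff-delta : ∀ z B {f} → Unique (z ∷ B) → f z ≉ 0 → (∀ x → x ∈ₗ B → f x ≈ 0) → divDiff z B f ≉ 0
  divDiff-delta z []      _        fz≉0 _      = fz≉0
  divDiff-delta z (c ∷ B) {f} distinct fz≉0 fB≈0 =
    divDiff-delta z B (distinct-tail distinct) quotient-z≉0 quotient-B≈0
    where
    fc≈0 = fB≈0 c (here refl)
    quotient-z≉0 : (f z - f c) * inv (toℕ z - toℕ c) ≉ 0
    quotient-z≉0 = *-≉0 (fz≉0 ∘ ≈-trans (≈-sym fz-fc≈fz))
                        (inv-≉0 (node-difference-≉0 (distinct-head distinct (here refl))))
      where
      fz-fc≈fz : f z - f c ≈ f z
      fz-fc≈fz = ≈-trans (-‿cong₂ ≈-refl fc≈0) (≡⇒≈ (x-0≡x (f z)))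
    quotient-B≈0 : ∀ x → x ∈ₗ B → (f x - f c) * inv (toℕ x - toℕ c) ≈ 0
    quotient-B≈0 x x∈B =
      ≈-trans (*-congʳ i (-‿cong₂ (fB≈0 x (there x∈B)) fc≈0)) (≡⇒≈ (cong (_* i) (x-0≡x 0)))
      where i = inv (toℕ x - toℕ c)

module Grid {p-1 : ℕ} (p-prime : Prime (suc p-1))
            (z : Fin (suc p-1)) (B : List (Fin (suc p-1))) (distinct : Unique (z ∷ B)) where

  open PrimeField p-prime
  open DividedDifference p-prime

  OnGrid : ∀ {t} → Vec (Fin p) t → Set
  OnGrid = VecAll.All (_∈ₗ z ∷ B)

  divDiffⁿ : ∀ t → (Vec (Fin p) t → ℕ) → ℕ
  divDiffⁿ zero    F = F []
  divDiffⁿ (suc t) F = divDiff z B (λ b → divDiffⁿ t (λ v → F (b ∷ v)))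

  divDiffⁿ-cong : ∀ t {F G} → (∀ v → OnGrid v → F v ≈ G v) → divDiffⁿ t F ≈ divDiffⁿ t G
  divDiffⁿ-cong zero    F≈G = F≈G [] []
  divDiffⁿ-cong (suc t) F≈G =
    divDiff-cong z B λ b b∈ → divDiffⁿ-cong t λ v v∈ → F≈G (b ∷ v) (b∈ ∷ v∈)

  divDiffⁿ-+ : ∀ t F G → divDiffⁿ t (λ v → F v + G v) ≈ divDiffⁿ t F + divDiffⁿ t G
  divDiffⁿ-+ zero    F G = ≈-refl
  divDiffⁿ-+ (suc t) F G =
    ≈-trans (divDiff-cong z B λ b _ → divDiffⁿ-+ t _ _) (divDiff-+ z B _ _)

  divDiffⁿ-*ˡ : ∀ t a F → divDiffⁿ t (λ v → a * F v) ≈ a * divDiffⁿ t F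
  divDiffⁿ-*ˡ zero    a F = ≈-refl
  divDiffⁿ-*ˡ (suc t) a F =
    ≈-trans (divDiff-cong z B λ b _ → divDiffⁿ-*ˡ t a _) (divDiff-*ˡ z B a _)

  divDiffⁿ-0 : ∀ t → divDiffⁿ t (λ _ → 0) ≈ 0
  divDiffⁿ-0 t = divDiffⁿ-*ˡ t 0 (λ _ → 0)

  -- One coordinate of a monomial of total degree below t ∣B∣ has degree below ∣B∣.
  divDiffⁿ-monomial : ∀ t (e : Monomial t) → degree e < t * length B →
                      divDiffⁿ t (monomial e ∘ Vec.map toℕ) ≈ 0
  divDiffⁿ-monomial (suc t) (e₀ ∷ e) deg< =
    ≈-trans (divDiff-cong z B λ b _ → factor b)
            (≈-trans (divDiff-*ˡ z B K (λ x → toℕ x ^ e₀)) (vanishes (e₀ <? length B)))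
    where
    K = divDiffⁿ t (monomial e ∘ Vec.map toℕ)
    factor : ∀ b → divDiffⁿ t (λ v → toℕ b ^ e₀ * monomial e (Vec.map toℕ v)) ≈ K * toℕ b ^ e₀
    factor b = ≈-trans (divDiffⁿ-*ˡ t (toℕ b ^ e₀) _) (≡⇒≈ (*-comm _ K))
    vanishes : Dec (e₀ < length B) → K * divDiff z B (λ x → toℕ x ^ e₀) ≈ 0
    vanishes (yes e₀<∣B∣) = ≈-trans (*-congˡ K (divDiff-pow z B distinct e₀ e₀<∣B∣)) (≡⇒≈ (*-zeroʳ K))
    vanishes (no e₀≮∣B∣)  = *-congʳ _ (divDiffⁿ-monomial t e
      (+-cancelˡ-< (length B) _ _ (≤-<-trans (+-monoˡ-≤ (degree e) (≮⇒≥ e₀≮∣B∣)) deg<)))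

  divDiffⁿ-poly : ∀ t {D} (P : Poly t) → Degree≤ D P → D < t * length B →
                  divDiffⁿ t (⟦ P ⟧ ∘ Vec.map toℕ) ≈ 0
  divDiffⁿ-poly t []            []          D< = divDiffⁿ-0 t
  divDiffⁿ-poly t ((a , e) ∷ P) (de ∷ dP) D< =
    ≈-trans (divDiffⁿ-+ t _ _)
      (+-cong (≈-trans (divDiffⁿ-*ˡ t a _)
                       (≈-trans (*-congˡ a (divDiffⁿ-monomial t e (≤-<-trans de D<)))
                                (≡⇒≈ (*-zeroʳ a))))
              (divDiffⁿ-poly t P dP D<))

  divDiffⁿ-delta : ∀ t {F} → F (replicate t z) ≉ 0 →
                   (∀ v → OnGrid v → VecAny.Any (_≢ z) v → F v ≈ 0) → divDiffⁿ t F ≉ 0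
  divDiffⁿ-delta zero    Fz≉0 _    = Fz≉0
  divDiffⁿ-delta (suc t) {F} Fz≉0 F≈0 =
    divDiff-delta z B distinct
      (divDiffⁿ-delta t Fz≉0 λ v v∈ v≢z → F≈0 (z ∷ v) (here refl ∷ v∈) (VecAny.there v≢z))
      (λ x x∈B → ≈-trans (divDiffⁿ-cong t λ v v∈ →
                            F≈0 (x ∷ v) (there x∈B ∷ v∈) (VecAny.here (≢z x∈B)))
                         (divDiffⁿ-0 t))
    where
    ≢z : ∀ {x} → x ∈ₗ B → x ≢ z
    ≢z x∈B x≡z = All.lookup (AllPairs.head distinct) x∈B (sym x≡z)

length-cartesianProduct : ∀ {A B : Set} (xs : List A) (ys : List B) →
                          length (cartesianProduct xs ys) ≡ length xs * length ys
length-cartesianProduct []       ys = refl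
length-cartesianProduct (x ∷ xs) ys =
  trans (List.length-++ (map (x ,_) ys)) (cong₂ _+_ (List.length-map _ ys) (length-cartesianProduct xs ys))

module LinearSystem {p-1 : ℕ} (p-prime : Prime (suc p-1)) where

  open PrimeField p-prime
  open import Data.List.Membership.DecPropositional (Fin._≟_ {p}) using () renaming (_∈?_ to _∈ₗ?_)

  linearForm : ∀ {t} → (Fin t → ℕ) → Vec (Fin p) t → ℕ
  linearForm {t} a w = sumFin t (λ i → toℕ (lookup w i) * a i)

  linearForm-0 : ∀ {t} (a : Fin t → ℕ) → linearForm a (replicate t zero) ≡ 0
  linearForm-0 {zero}  a = refl
  linearForm-0 {suc t} a = linearForm-0 (a ∘ suc)

  module SolutionPolynomial {d t : ℕ} (L : Fin d → Fin t → ℕ) where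

    factors : List (Fin d × ℕ)
    factors = cartesianProduct (allFin d) nonzeroResidues

    factor : Fin d × ℕ → Poly t
    factor kc = affine (- proj₂ kc) (L (proj₁ kc))

    E : Poly t
    E = ∏ᴾ (map factor factors)

    evalE : Vec (Fin p) t → ℕ
    evalE = ⟦ E ⟧ ∘ Vec.map toℕ

    ⟦factor⟧ : ∀ k c w → ⟦ factor (k , c) ⟧ (Vec.map toℕ w) ≡ - c + linearForm (L k) w
    ⟦factor⟧ k c w = trans (⟦affine⟧ (- c) (L k) (Vec.map toℕ w))
      (cong (- c +_) (sumFin-cong t λ i → cong (_* L k i) (lookup-map i toℕ w)))

    ⟦E⟧ : ∀ w → evalE w ≡ product (map (λ kc → ⟦ factor kc ⟧ (Vec.map toℕ w)) factors)
    ⟦E⟧ w = trans (⟦∏ᴾ⟧ (map factor factors) (Vec.map toℕ w)) (cong product (sym (List.map-∘ factors)))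

    Degree≤-E : Degree≤ (d * p-1) E
    Degree≤-E = subst (λ D → Degree≤ D E) number-of-factors
      (Degree≤-∏ᴾ (map factor factors)
        (All.map⁺ (All.tabulate λ {kc} _ → Degree≤-affine (- proj₂ kc) (L (proj₁ kc)))))
      where
      number-of-factors : length (map factor factors) * 1 ≡ d * p-1
      number-of-factors = begin
        length (map factor factors) * 1 ≡⟨ *-identityʳ _ ⟩
        length (map factor factors)     ≡⟨ List.length-map factor factors ⟩
        length factors                  ≡⟨ length-cartesianProduct (allFin d) nonzeroResidues ⟩
        length (allFin d) * length nonzeroResidues
          ≡⟨ cong₂ _*_ (List.length-tabulate {n = d} (λ i → i)) (List.length-applyUpTo suc p-1) ⟩
        d * p-1                         ∎
        where open ≡-Reasoning

    E[0]≉0 : evalE (replicate t zero) ≉ 0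
    E[0]≉0 E0≈0 = product-≉0 (All.map⁺ (All.tabulate factor≉0)) (≈-trans (≡⇒≈ (sym (⟦E⟧ _))) E0≈0)
      where
      factor≉0 : ∀ {kc} → kc ∈ₗ factors → ⟦ factor kc ⟧ (Vec.map toℕ (replicate t zero)) ≉ 0
      factor≉0 {k , c} kc∈ factor≈0 =
        nonzeroResidue⇒-≉0 (proj₂ (∈-cartesianProduct⁻ (allFin d) _ kc∈))
                           (≈-trans (≡⇒≈ (sym at-0)) factor≈0)
        where
        at-0 : ⟦ factor (k , c) ⟧ (Vec.map toℕ (replicate t zero)) ≡ - c
        at-0 = trans (⟦factor⟧ k c _) (trans (cong (- c +_) (linearForm-0 (L k))) (+-identityʳ (- c)))

    E≉0⇒solution : ∀ w → evalE w ≉ 0 → ∀ k → linearForm (L k) w ≈ 0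
    E≉0⇒solution w Ew≉0 k with linearForm (L k) w ≈? 0
    ... | yes Lw≈0 = Lw≈0
    ... | no  Lw≉0 =
      ⊥-elim (Ew≉0 (≈-trans (≡⇒≈ (⟦E⟧ w)) (product-≈0 _ (∈-map⁺ _ kc∈factors) factor≈0)))
      where
      Lw = linearForm (L k) w
      c = Lw % p
      kc∈factors : (k , c) ∈ₗ factors
      kc∈factors = ∈-cartesianProduct⁺ (∈-allFin k) (%∈nonzeroResidues Lw Lw≉0)
      factor≈0 : ⟦ factor (k , c) ⟧ (Vec.map toℕ w) ≈ 0
      factor≈0 = begin
        ⟦ factor (k , c) ⟧ (Vec.map toℕ w) ≡⟨ ⟦factor⟧ k c w ⟩
        - c + Lw                           ≈⟨ +-cong (≈-refl { - c}) (≈-% Lw) ⟩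
        - c + c                            ≡⟨ +-comm (- c) c ⟩
        c - c                              ≈⟨ x-x≈0 c ⟩
        0                                  ∎
        where open ≈-Reasoning

  nonzero-grid-solution :
    ∀ {d t} (B : List (Fin p)) → Unique (zero ∷ B) → (L : Fin d → Fin t → ℕ) → d * p-1 < t * length B →
    ∃ λ w → VecAll.All (_∈ₗ zero ∷ B) w × VecAny.Any (_≢ zero) w × ∀ k → linearForm (L k) w ≈ 0
  nonzero-grid-solution {d} {t} B distinct L d[p-1]<t∣B∣ = from-search search
    where
    open Grid p-prime zero B distinct
    open SolutionPolynomial L

    Witness : Vec (Fin p) t → Set
    Witness w = OnGrid w × VecAny.Any (_≢ zero) w × evalE w ≉ 0

    search : Dec (∃ Witness)
    search = searchable-Vec (searchable-Fin p) t λ w →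
      VecAll.all? (_∈ₗ? zero ∷ B) w ×-dec
      VecAny.any? (λ x → ¬? (x Fin.≟ zero)) w ×-dec
      ¬? (evalE w ≈? 0)

    from-search : Dec (∃ Witness) →
                  ∃ λ w → OnGrid w × VecAny.Any (_≢ zero) w × ∀ k → linearForm (L k) w ≈ 0
    from-search (yes (w , onGrid , w≢0 , Ew≉0)) = w , onGrid , w≢0 , E≉0⇒solution w Ew≉0
    from-search (no ∄) =
      ⊥-elim (divDiffⁿ-delta t E[0]≉0 E-vanishes (divDiffⁿ-poly t E Degree≤-E d[p-1]<t∣B∣))
      where
      E-vanishes : ∀ w → OnGrid w → VecAny.Any (_≢ zero) w → evalE w ≈ 0
      E-vanishes w onGrid w≢0 = decidable-stable (evalE w ≈? 0) λ Ew≉0 → ∄ (w , onGrid , w≢0 , Ew≉0)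

elements : ∀ {n} → Subset n → List (Fin n)
elements []            = []
elements (inside ∷ s)  = zero ∷ map suc (elements s)
elements (outside ∷ s) = map suc (elements s)

length-elements : ∀ {n} (s : Subset n) → length (elements s) ≡ ∣ s ∣
length-elements []            = refl
length-elements (inside ∷ s)  = cong suc (trans (List.length-map suc (elements s)) (length-elements s))
length-elements (outside ∷ s) = trans (List.length-map suc (elements s)) (length-elements s)

∈-elements⁻ : ∀ {n} (s : Subset n) {x} → x ∈ₗ elements s → x ∈ s
∈-elements⁻ (inside ∷ s)  (here refl) = Vec.here
∈-elements⁻ (inside ∷ s)  (there x∈)
  with _ , y∈ , refl ← ∈-map⁻ suc x∈ = Vec.there (∈-elements⁻ s y∈)
∈-elements⁻ (outside ∷ s) x∈
  with _ , y∈ , refl ← ∈-map⁻ suc x∈ = Vec.there (∈-elements⁻ s y∈)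

elements-unique : ∀ {n} (s : Subset n) → Unique (elements s)
elements-unique []            = []
elements-unique (inside ∷ s)  =
  All.map⁺ (All.tabulate λ _ ()) ∷ Unique.map⁺ Fin.suc-injective (elements-unique s)
elements-unique (outside ∷ s) = Unique.map⁺ Fin.suc-injective (elements-unique s)

≤-ceilDiv-* : ∀ m k → 0 < k → m ≤ ceilDiv m k * k
≤-ceilDiv-* m (suc k) _ = +-cancelʳ-≤ k m (Q * suc k) (begin
  m + k                      ≡⟨ m≡m%n+[m/n]*n (m + k) (suc k) ⟩
  (m + k) % suc k + Q * suc k ≤⟨ +-monoˡ-≤ (Q * suc k) (s≤s⁻¹ (m%n<n (m + k) (suc k))) ⟩
  k + Q * suc k              ≡⟨ +-comm k (Q * suc k) ⟩
  Q * suc k + k              ∎)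
  where
  open ≤-Reasoning
  Q = (m + k) / suc k

isNonzero : ∀ {n} → Fin n → Bool
isNonzero zero    = outside
isNonzero (suc _) = inside

support : ∀ {n t} → Vec (Fin n) t → Subset t
support = Vec.map isNonzero

gridSolution⇒HasAZeroSum : ∀ {p-1 d t} (A : Subset (suc p-1)) (g : Fin t → Elem (suc p-1) d) w →
  VecAll.All (_∈ₗ zero ∷ elements A) w → VecAny.Any (_≢ zero) w →
  (∀ k → suc p-1 ∣ sumFin t (λ i → toℕ (lookup w i) * toℕ (g i k))) → HasAZeroSum (suc p-1) d t A g
gridSolution⇒HasAZeroSum {p-1} {t = t} A g w onGrid w≢0 zeroSums =
  support w , nonempty , lookup w , weights∈A ,
  λ k → subst (suc p-1 ∣_) (sym (sumFin-cong t λ i → weighted i (toℕ (g i k)))) (zeroSums k)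
  where
  in-support : ∀ {i} → lookup w i ≢ zero → i ∈ support w
  in-support {i} wᵢ≢0 with lookup w i in wᵢ≡x
  ... | zero  = ⊥-elim (wᵢ≢0 refl)
  ... | suc _ = lookup⇒[]= i (support w) (trans (lookup-map i isNonzero w) (cong isNonzero wᵢ≡x))

  out-of-support : ∀ {i} → i ∈ support w → lookup w i ≢ zero
  out-of-support {i} i∈S wᵢ≡0
    with () ← trans (sym ([]=⇒lookup i∈S)) (trans (lookup-map i isNonzero w) (cong isNonzero wᵢ≡0))

  weighted : ∀ i y → (if lookup (support w) i then toℕ (lookup w i) * y else 0) ≡ toℕ (lookup w i) * y
  weighted i y rewrite lookup-map i isNonzero w with lookup w i
  ... | zero  = refl
  ... | suc _ = refl

  nonempty : Nonempty (support w)
  nonempty = VecAny.index w≢0 , in-support (VecAny.lookup-index w≢0)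

  weights∈A : ∀ i → i ∈ support w → lookup w i ∈ A
  weights∈A i i∈S with VecAll.lookup⁺ onGrid i
  ... | here wᵢ≡0  = ⊥-elim (out-of-support i∈S wᵢ≡0)
  ... | there wᵢ∈A = ∈-elements⁻ A wᵢ∈A

aProperty-bound : ∀ {p-1 d} → Prime (suc p-1) →
  (A : Subset (suc p-1)) → Nonempty A → (∀ a → a ∈ A → 1 ≤ toℕ a) →
  1 ≤ ceilDiv (d * p-1 + 1) ∣ A ∣ × AProperty (suc p-1) d A (ceilDiv (d * p-1 + 1) ∣ A ∣)
aProperty-bound {p-1} {d} p-prime A (x , x∈A) A≥1 = 1≤N , has-zero-sum
  where
  open LinearSystem p-prime
  open PrimeField p-prime using (≈0⇒∣)
  N = ceilDiv (d * p-1 + 1) ∣ A ∣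

  d[p-1]+1≤N∣A∣ : d * p-1 + 1 ≤ N * ∣ A ∣
  d[p-1]+1≤N∣A∣ = ≤-ceilDiv-* (d * p-1 + 1) ∣ A ∣ (≤-<-trans z≤n (x∈p⇒∣p-x∣<∣p∣ x∈A))

  1≤N : 1 ≤ N
  1≤N = n≢0⇒n>0 λ N≡0 →
    n≮n 0 (≤-trans (m≤n+m 1 (d * p-1)) (subst (λ n → _ ≤ n * ∣ A ∣) N≡0 d[p-1]+1≤N∣A∣))

  d[p-1]<N∣A∣ : d * p-1 < N * length (elements A)
  d[p-1]<N∣A∣ = subst (λ n → d * p-1 < N * n) (sym (length-elements A))
                      (subst (_≤ N * ∣ A ∣) (+-comm (d * p-1) 1) d[p-1]+1≤N∣A∣)

  distinct : Unique (zero ∷ elements A)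
  distinct = All.tabulate (λ x∈ → λ { refl → n≮n 0 (A≥1 zero (∈-elements⁻ A x∈)) })
           ∷ elements-unique A

  has-zero-sum : AProperty (suc p-1) d A N
  has-zero-sum g
    with w , onGrid , w≢0 , solution
           ← nonzero-grid-solution (elements A) distinct (λ k i → toℕ (g i k)) d[p-1]<N∣A∣
    = gridSolution⇒HasAZeroSum A g w onGrid w≢0 (≈0⇒∣ ∘ solution)

corollary1p1 : (p d : ℕ) → Prime p → 1 ≤ d →
    (A : Subset p) → Nonempty A → (∀ a → a ∈ A → 1 ≤ toℕ a) →
    Σ ℕ (λ m → IsDA p d A m × m ≤ ceilDiv (d * (p ∸ 1) + 1) ∣ A ∣)
corollary1p1 zero      d p-prime _ A nonempty A≥1 = ⊥-elim (¬prime[0] p-prime)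
corollary1p1 (suc p-1) d p-prime _ A nonempty A≥1
  with 1≤N , N-has-property ← aProperty-bound {d = d} p-prime A nonempty A≥1
  = least-positive (aProperty? (suc p-1) d A) 1≤N N-has-property
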